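{- Let $(\mathcal{S}_n)_{n\ge1}$ be the Sierpiński gasket graphs. For every $n\geq 2$, the largest cardinality of an independent set of $\mathcal{S}_n$ containing exactly $0$, exactly $1$, and exactly $2$ of the outmost vertices is, respectively, $\frac{3^{n-1}-1}{2}$, $\frac{3^{n-1}+1}{2}$, and $\frac{3^{n-1}+1}{2}$.
   Context: The Sierpiński gasket graphs $\mathcal{S}_n$, each with three distinguished "outmost" vertices $A_n,B_n,C_n$, are defined recursively: $\mathcal{S}_1$ is a triangle with vertices $A_1,B_1,C_1$. Given $\mathcal{S}_n$, take three disjoint copies $\mathcal{S}_n^{(1)},\mathcal{S}_n^{(2)},\mathcal{S}_n^{(3)}$ with outmost vertices $A_n^{(\theta)},B_n^{(\theta)},C_n^{(\theta)}$; identify $B_n^{(1)}$ with $A_n^{(2)}$, $C_n^{(1)}$ with $A_n^{(3)}$, and $C_n^{(2)}$ with $B_n^{(3)}$; the result is $\mathcal{S}_{n+1}$, with outmost vertices $A_{n+1}=A_n^{(1)}$, $B_{n+1}=B_n^{(2)}$, $C_{n+1}=C_n^{(3)}$. An independent set is a set of pairwise non-adjacent vertices. -}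

module Defs where

open import Data.Nat using (ℕ; zero; suc; _∸_; _≤_)
open import Data.Empty using (⊥)
open import Data.Product using (_×_; ∃)
open import Data.List using (List; length)
open import Data.List.Membership.Propositional using (_∈_)
open import Data.List.Relation.Unary.Unique.Propositional using (Unique)
open import Relation.Binary.PropositionalEquality using (_≡_; _≢_)
open import Function.Bundles using (_⇔_)

-- The three outmost vertices / the three copies (A ↦ copy 1, B ↦ copy 2, C ↦ copy 3).
data Corner : Set where
  A B C : Corner

-- The three gluing points of S_{n+1}:
--   g12 = B^(1) = A^(2),  g13 = C^(1) = A^(3),  g23 = C^(2) = B^(3).
data Glue : Set where
  g12 g13 g23 : Glue

-- Level k corresponds to the gasket S_{k+1}.
-- Non-outmost vertices of S_{k+1} (quotient-free representation of the gluing).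
Inner : ℕ → Set
data InnerSuc (k : ℕ) : Set where
  inCopy : Corner → Inner k → InnerSuc k
  glued  : Glue → InnerSuc k

Inner zero    = ⊥
Inner (suc k) = InnerSuc k

data Vtx (k : ℕ) : Set where
  out : Corner → Vtx k
  inn : Inner k → Vtx k

embed : ∀ {k} → Corner → Vtx k → Vtx (suc k)
embed A (out A) = out A
embed A (out B) = inn (glued g12)
embed A (out C) = inn (glued g13)
embed B (out A) = inn (glued g12)
embed B (out B) = out B
embed B (out C) = inn (glued g23)
embed C (out A) = inn (glued g13)
embed C (out B) = inn (glued g23)
embed C (out C) = out C
embed θ (inn x) = inn (inCopy θ x)

data Adj : (k : ℕ) → Vtx k → Vtx k → Set where
  base : ∀ {c d} → c ≢ d → Adj zero (out c) (out d)
  lift : ∀ {k} (θ : Corner) {u v : Vtx k} {x y : Vtx (suc k)} →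
         Adj k u v → embed θ u ≡ x → embed θ v ≡ y → Adj (suc k) x y

VS : ℕ → Set
VS n = Vtx (n ∸ 1)

AdjS : (n : ℕ) → VS n → VS n → Set
AdjS n = Adj (n ∸ 1)

IsIndependent : (n : ℕ) → List (VS n) → Set
IsIndependent n I = Unique I × (∀ {u v} → u ∈ I → v ∈ I → AdjS n u v → ⊥)

ContainsExactlyOut : (n : ℕ) → List (VS n) → ℕ → Set
ContainsExactlyOut n I k =
  ∃ λ (Cs : List Corner) → Unique Cs × length Cs ≡ k × (∀ c → (out c ∈ I) ⇔ (c ∈ Cs))

MaxIndepOut : (n k m : ℕ) → Set
MaxIndepOut n k m =
  (∃ λ I → IsIndependent n I × ContainsExactlyOut n I k × length I ≡ m) ×
  (∀ I → IsIndependent n I → ContainsExactlyOut n I k → length I ≤ m)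

-- Let I be an independent set of S_{k+1} containing w outmost vertices. Restricted to the three
-- copies of S_k, the sizes add up to |I| + g and the outmost counts to w + 2g, where g counts the
-- gluing points in I. By induction 2|I| + 1 ≤ 3^k + 2⌈w/2⌉, the step being the inequality
-- ⌈a/2⌉ + ⌈b/2⌉ + ⌈c/2⌉ ≤ ⌈(a+b+c)/2⌉ + 1. The bound is attained by sets in which every copy
-- contains at most one of its outmost vertices, built by choosing the gluing points level by level.
module Submission where

open import Defs
open import Data.Nat using (ℕ; zero; suc; _+_; _*_; _∸_; _^_; _≤_; z≤n; s≤s; ⌈_/2⌉)
open import Data.Nat.Properties
open import Data.Nat.DivMod using (_/_; m*n/n≡m)
open import Data.Nat.ListAction using (sum)
open import Data.Nat.Tactic.RingSolver using (solve-∀)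
open import Data.Bool using (Bool; true; false; T; T?)
open import Data.Empty using (⊥; ⊥-elim)
open import Data.Maybe using (Maybe; just; nothing)
open import Data.Maybe.Properties using (just-injective)
open import Data.Product using (_×_; _,_; proj₂)
open import Data.List using (List; []; _∷_; _++_; map; length; filterᵇ; cartesianProductWith)
open import Data.List.Membership.Propositional using (_∈_)
open import Data.List.Membership.Propositional.Properties
  using (∈-++⁺ˡ; ∈-++⁺ʳ; ∈-map⁺; ∈-map⁻; ∈-filter⁺; ∈-filter⁻; ∈-cartesianProductWith⁺; ∈-cartesianProductWith⁻)
open import Data.List.Membership.Propositional.Properties.WithK using (unique∧set⇒bag)
open import Data.List.Relation.Unary.All using ([]; _∷_)
open import Data.List.Relation.Unary.AllPairs using ([]; _∷_)
open import Data.List.Relation.Unary.Any using (here; there; any?)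
open import Data.List.Relation.Unary.Unique.Propositional using (Unique)
open import Data.List.Relation.Unary.Unique.Propositional.Properties using (map⁺; ++⁺; filter⁺; cartesianProductWith⁺)
open import Data.List.Relation.Binary.Disjoint.Propositional using (Disjoint)
open import Data.List.Relation.Binary.BagAndSetEquality using (_∼[_]_; set; ∼bag⇒↭)
open import Data.List.Relation.Binary.Permutation.Propositional.Properties using (↭-length)
open import Relation.Nullary using (yes; no)
open import Relation.Nullary.Decidable using (⌊_⌋; map′; toWitness; fromWitness; _×-dec_)
open import Relation.Binary.Definitions using (DecidableEquality)
open import Relation.Binary.PropositionalEquality
open import Function using (_∘_)
open import Function.Bundles using (_⇔_; Equivalence; mk⇔)
open import Function.Properties.Equivalence using () renaming (trans to ⇔-trans; sym to ⇔-sym)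

open Equivalence using (to)

allCorner : List Corner
allCorner = A ∷ B ∷ C ∷ []

allGlue : List Glue
allGlue = g12 ∷ g13 ∷ g23 ∷ []

allInner : ∀ k → List (Inner k)
allInner zero    = []
allInner (suc k) = map glued allGlue ++ cartesianProductWith inCopy allCorner (allInner k)

allVtx : ∀ k → List (Vtx k)
allVtx k = map out allCorner ++ map inn (allInner k)

∈-allCorner : ∀ c → c ∈ allCorner
∈-allCorner A = here refl
∈-allCorner B = there (here refl)
∈-allCorner C = there (there (here refl))

∈-allGlue : ∀ g → g ∈ allGlue
∈-allGlue g12 = here refl
∈-allGlue g13 = there (here refl)
∈-allGlue g23 = there (there (here refl))

∈-allInner : ∀ k x → x ∈ allInner k
∈-allInner (suc k) (glued g)    = ∈-++⁺ˡ (∈-map⁺ glued (∈-allGlue g))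
∈-allInner (suc k) (inCopy θ x) =
  ∈-++⁺ʳ (map glued allGlue) (∈-cartesianProductWith⁺ inCopy (∈-allCorner θ) (∈-allInner k x))

∈-allVtx : ∀ k v → v ∈ allVtx k
∈-allVtx k (out c) = ∈-++⁺ˡ (∈-map⁺ out (∈-allCorner c))
∈-allVtx k (inn x) = ∈-++⁺ʳ (map out allCorner) (∈-map⁺ inn (∈-allInner k x))

allCorner-unique : Unique allCorner
allCorner-unique = ((λ ()) ∷ (λ ()) ∷ []) ∷ ((λ ()) ∷ []) ∷ [] ∷ []

allGlue-unique : Unique allGlue
allGlue-unique = ((λ ()) ∷ (λ ()) ∷ []) ∷ ((λ ()) ∷ []) ∷ [] ∷ []

allInner-unique : ∀ k → Unique (allInner k)
allInner-unique zero    = []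
allInner-unique (suc k) =
  ++⁺ (map⁺ {f = glued} (λ { refl → refl }) allGlue-unique)
      (cartesianProductWith⁺ inCopy (λ { refl → refl , refl }) allCorner-unique (allInner-unique k))
      glued∩copies
  where
  glued∩copies : Disjoint (map glued allGlue) (cartesianProductWith inCopy allCorner (allInner k))
  glued∩copies (p , q) with _ , _ , refl ← ∈-map⁻ glued p
    with _ , _ , _ , _ , () ← ∈-cartesianProductWith⁻ inCopy allCorner (allInner k) q

allVtx-unique : ∀ k → Unique (allVtx k)
allVtx-unique k =
  ++⁺ (map⁺ {f = out} (λ { refl → refl }) allCorner-unique) (map⁺ {f = inn} (λ { refl → refl }) (allInner-unique k))
      out∩inn
  where
  out∩inn : Disjoint (map out allCorner) (map inn (allInner k))
  out∩inn (p , q) with _ , _ , refl ← ∈-map⁻ out p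
    with _ , _ , () ← ∈-map⁻ inn q

_≟ᶜ_ : DecidableEquality Corner
A ≟ᶜ A = yes refl
A ≟ᶜ B = no (λ ())
A ≟ᶜ C = no (λ ())
B ≟ᶜ A = no (λ ())
B ≟ᶜ B = yes refl
B ≟ᶜ C = no (λ ())
C ≟ᶜ A = no (λ ())
C ≟ᶜ B = no (λ ())
C ≟ᶜ C = yes refl

_≟ᵍ_ : DecidableEquality Glue
g12 ≟ᵍ g12 = yes refl
g12 ≟ᵍ g13 = no (λ ())
g12 ≟ᵍ g23 = no (λ ())
g13 ≟ᵍ g12 = no (λ ())
g13 ≟ᵍ g13 = yes refl
g13 ≟ᵍ g23 = no (λ ())
g23 ≟ᵍ g12 = no (λ ())
g23 ≟ᵍ g13 = no (λ ())
g23 ≟ᵍ g23 = yes refl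

_≟ⁱ_ : ∀ {k} → DecidableEquality (Inner k)
_≟ⁱ_ {zero}  ()
_≟ⁱ_ {suc k} (glued g)    (glued h)    = map′ (cong glued) (λ { refl → refl }) (g ≟ᵍ h)
_≟ⁱ_ {suc k} (glued _)    (inCopy _ _) = no (λ ())
_≟ⁱ_ {suc k} (inCopy _ _) (glued _)    = no (λ ())
_≟ⁱ_ {suc k} (inCopy θ x) (inCopy φ y) =
  map′ (λ (θ≡φ , x≡y) → cong₂ inCopy θ≡φ x≡y) (λ { refl → refl , refl }) (θ ≟ᶜ φ ×-dec x ≟ⁱ y)

_≟ᵛ_ : ∀ {k} → DecidableEquality (Vtx k)
out c ≟ᵛ out d = map′ (cong out) (λ { refl → refl }) (c ≟ᶜ d)
out _ ≟ᵛ inn _ = no (λ ())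
inn _ ≟ᵛ out _ = no (λ ())
inn x ≟ᵛ inn y = map′ (cong inn) (λ { refl → refl }) (x ≟ⁱ y)

bit : Bool → ℕ
bit true  = 1
bit false = 0

count : ∀ {X : Set} → (X → Bool) → List X → ℕ
count P []       = 0
count P (x ∷ xs) = bit (P x) + count P xs

count-++ : ∀ {X : Set} (P : X → Bool) xs ys → count P (xs ++ ys) ≡ count P xs + count P ys
count-++ P []       ys = refl
count-++ P (x ∷ xs) ys = trans (cong (bit (P x) +_) (count-++ P xs ys)) (sym (+-assoc (bit (P x)) _ _))

count-map : ∀ {X Y : Set} (P : Y → Bool) (f : X → Y) xs → count P (map f xs) ≡ count (P ∘ f) xs
count-map P f []       = refl
count-map P f (x ∷ xs) = cong (bit (P (f x)) +_) (count-map P f xs)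

count-cong : ∀ {X : Set} {P Q : X → Bool} → P ≗ Q → ∀ xs → count P xs ≡ count Q xs
count-cong P≗Q []       = refl
count-cong P≗Q (x ∷ xs) = cong₂ _+_ (cong bit (P≗Q x)) (count-cong P≗Q xs)

count-cartesianProductWith : ∀ {X Y Z : Set} (P : Z → Bool) (f : X → Y → Z) xs ys →
  count P (cartesianProductWith f xs ys) ≡ sum (map (λ x → count (P ∘ f x) ys) xs)
count-cartesianProductWith P f []       ys = refl
count-cartesianProductWith P f (x ∷ xs) ys =
  trans (count-++ P (map (f x) ys) _)
        (cong₂ _+_ (count-map P (f x) ys) (count-cartesianProductWith P f xs ys))

length-filterᵇ : ∀ {X : Set} (P : X → Bool) xs → length (filterᵇ P xs) ≡ count P xs
length-filterᵇ P []       = refl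
length-filterᵇ P (x ∷ xs) with P x
... | true  = cong suc (length-filterᵇ P xs)
... | false = length-filterᵇ P xs

∈-filterᵇ : ∀ {X : Set} {P : X → Bool} {xs} → (∀ x → x ∈ xs) → ∀ {x} → x ∈ filterᵇ P xs ⇔ T (P x)
∈-filterᵇ {P = P} {xs} complete {x} = mk⇔ (proj₂ ∘ ∈-filter⁻ (T? ∘ P) {xs = xs}) (∈-filter⁺ (T? ∘ P) (complete x))

-- Two duplicate-free lists with the same members are permutations of each other.
length≡count : ∀ {X : Set} {P : X → Bool} {xs ys} → Unique xs → (∀ x → x ∈ xs) →
  Unique ys → (∀ y → y ∈ ys ⇔ T (P y)) → length ys ≡ count P xs
length≡count {P = P} {xs} {ys} xs-unique complete ys-unique ∈ys⇔ =
  trans (↭-length (∼bag⇒↭ (unique∧set⇒bag ys-unique (filter⁺ (T? ∘ P) xs-unique) ys≈members)))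
        (length-filterᵇ P xs)
  where
  ys≈members : ys ∼[ set ] filterᵇ P xs
  ys≈members {y} = ⇔-trans (∈ys⇔ y) (⇔-sym (∈-filterᵇ complete))

Independent : ∀ k → (Vtx k → Bool) → Set
Independent k P = ∀ {u v} → Adj k u v → T (P u) → T (P v) → ⊥

size : ∀ k → (Vtx k → Bool) → ℕ
size k P = count P (allVtx k)

corners : ∀ {k} → (Vtx k → Bool) → ℕ
corners P = count (P ∘ out) allCorner

gluings : ∀ {k} → (Vtx (suc k) → Bool) → ℕ
gluings P = count (P ∘ inn ∘ glued) allGlue

interior : ∀ k → (Inner k → Bool) → ℕ
interior k Q = count Q (allInner k)

size-cong : ∀ k {P Q : Vtx k → Bool} → P ≗ Q → size k P ≡ size k Q
size-cong k P≗Q = count-cong P≗Q (allVtx k)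

size≡corners+interior : ∀ k P → size k P ≡ corners P + interior k (P ∘ inn)
size≡corners+interior k P =
  trans (count-++ P (map out allCorner) (map inn (allInner k)))
        (cong₂ _+_ (count-map P out allCorner) (count-map P inn (allInner k)))

interior-suc : ∀ k Q → interior (suc k) Q ≡
  count (Q ∘ glued) allGlue + (interior k (Q ∘ inCopy A) + (interior k (Q ∘ inCopy B) + (interior k (Q ∘ inCopy C) + 0)))
interior-suc k Q =
  trans (count-++ Q (map glued allGlue) (cartesianProductWith inCopy allCorner (allInner k)))
        (cong₂ _+_ (count-map Q glued allGlue) (count-cartesianProductWith Q inCopy allCorner (allInner k)))

restrict-independent : ∀ {k} {P : Vtx (suc k) → Bool} → Independent (suc k) P → ∀ θ → Independent k (P ∘ embed θ)
restrict-independent independent θ adj = independent (lift θ adj refl refl)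

-- Each gluing point is a corner of two copies.
corners-suc : ∀ {k} (P : Vtx (suc k) → Bool) →
  corners (P ∘ embed A) + corners (P ∘ embed B) + corners (P ∘ embed C) ≡ 2 * gluings P + corners P
corners-suc P = shared (bit (P (out A))) (bit (P (out B))) (bit (P (out C)))
                       (bit (P (inn (glued g12)))) (bit (P (inn (glued g13)))) (bit (P (inn (glued g23))))
  where
  shared : ∀ a b c x y z →
    (a + (x + (y + 0))) + (x + (b + (z + 0))) + (y + (z + (c + 0))) ≡ 2 * (x + (y + (z + 0))) + (a + (b + (c + 0)))
  shared = solve-∀

size-suc : ∀ k (P : Vtx (suc k) → Bool) →
  size (suc k) P + gluings P ≡ size k (P ∘ embed A) + size k (P ∘ embed B) + size k (P ∘ embed C)
size-suc k P = begin
  size (suc k) P + gluings P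
    ≡⟨ cong (_+ gluings P) (trans (size≡corners+interior (suc k) P) (cong (corners P +_) (interior-suc k (P ∘ inn)))) ⟩
  corners P + (gluings P + (iA + (iB + (iC + 0)))) + gluings P
    ≡⟨ regroup (bit (P (out A))) (bit (P (out B))) (bit (P (out C)))
               (bit (P (inn (glued g12)))) (bit (P (inn (glued g13)))) (bit (P (inn (glued g23)))) iA iB iC ⟩
  (corners (P ∘ embed A) + iA) + (corners (P ∘ embed B) + iB) + (corners (P ∘ embed C) + iC)
    ≡⟨ sym (cong₂ _+_ (cong₂ _+_ (size≡corners+interior k (P ∘ embed A)) (size≡corners+interior k (P ∘ embed B)))
                      (size≡corners+interior k (P ∘ embed C))) ⟩
  size k (P ∘ embed A) + size k (P ∘ embed B) + size k (P ∘ embed C) ∎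
  where
  open ≡-Reasoning
  iA iB iC : ℕ
  iA = interior k (P ∘ inn ∘ inCopy A)
  iB = interior k (P ∘ inn ∘ inCopy B)
  iC = interior k (P ∘ inn ∘ inCopy C)
  regroup : ∀ a b c x y z i j l →
    (a + (b + (c + 0))) + ((x + (y + (z + 0))) + (i + (j + (l + 0)))) + (x + (y + (z + 0)))
    ≡ ((a + (x + (y + 0))) + i) + ((x + (b + (z + 0))) + j) + ((y + (z + (c + 0))) + l)
  regroup = solve-∀

⌈m/2⌉+⌈n/2⌉≤⌈1+m+n/2⌉ : ∀ m n → ⌈ m /2⌉ + ⌈ n /2⌉ ≤ ⌈ suc (m + n) /2⌉
⌈m/2⌉+⌈n/2⌉≤⌈1+m+n/2⌉ zero          n = ⌈n/2⌉-mono (n≤1+n n)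
⌈m/2⌉+⌈n/2⌉≤⌈1+m+n/2⌉ (suc zero)    n = ≤-refl
⌈m/2⌉+⌈n/2⌉≤⌈1+m+n/2⌉ (suc (suc m)) n = s≤s (⌈m/2⌉+⌈n/2⌉≤⌈1+m+n/2⌉ m n)

⌈a/2⌉+⌈b/2⌉+⌈c/2⌉≤1+⌈a+b+c/2⌉ : ∀ a b c → ⌈ a /2⌉ + ⌈ b /2⌉ + ⌈ c /2⌉ ≤ suc ⌈ a + b + c /2⌉
⌈a/2⌉+⌈b/2⌉+⌈c/2⌉≤1+⌈a+b+c/2⌉ a b c =
  ≤-trans (+-monoˡ-≤ ⌈ c /2⌉ (⌈m/2⌉+⌈n/2⌉≤⌈1+m+n/2⌉ a b)) (⌈m/2⌉+⌈n/2⌉≤⌈1+m+n/2⌉ (suc (a + b)) c)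

⌈2m+n/2⌉≡m+⌈n/2⌉ : ∀ m n → ⌈ 2 * m + n /2⌉ ≡ m + ⌈ n /2⌉
⌈2m+n/2⌉≡m+⌈n/2⌉ zero    n = refl
⌈2m+n/2⌉≡m+⌈n/2⌉ (suc m) n =
  trans (cong (λ x → ⌈ x + n /2⌉) (*-suc 2 m)) (cong suc (⌈2m+n/2⌉≡m+⌈n/2⌉ m n))

three-copies : ∀ N g (n : Corner → ℕ) → N + g ≡ n A + n B + n C →
  2 * N + 1 + (2 * g + 2) ≡ (2 * n A + 1) + (2 * n B + 1) + (2 * n C + 1)
three-copies N g n sizes = begin
  2 * N + 1 + (2 * g + 2)                         ≡⟨ doubled N g ⟩
  2 * (N + g) + 3                                 ≡⟨ cong (λ m → 2 * m + 3) sizes ⟩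
  2 * (n A + n B + n C) + 3                       ≡⟨ distribute (n A) (n B) (n C) ⟩
  (2 * n A + 1) + (2 * n B + 1) + (2 * n C + 1)   ∎
  where
  open ≡-Reasoning
  doubled : ∀ N g → 2 * N + 1 + (2 * g + 2) ≡ 2 * (N + g) + 3
  doubled = solve-∀
  distribute : ∀ a b c → 2 * (a + b + c) + 3 ≡ (2 * a + 1) + (2 * b + 1) + (2 * c + 1)
  distribute = solve-∀

collect : ∀ t a b c → (t + 2 * a) + (t + 2 * b) + (t + 2 * c) ≡ 3 * t + 2 * (a + b + c)
collect = solve-∀

bound-step : ∀ t N g w (n c : Corner → ℕ) →
  N + g ≡ n A + n B + n C → c A + c B + c C ≡ 2 * g + w →
  (∀ θ → 2 * n θ + 1 ≤ t + 2 * ⌈ c θ /2⌉) → 2 * N + 1 ≤ 3 * t + 2 * ⌈ w /2⌉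
bound-step t N g w n c sizes corners≡ bound =
  +-cancelʳ-≤ (2 * g + 2) (2 * N + 1) (3 * t + 2 * ⌈ w /2⌉) (begin
    2 * N + 1 + (2 * g + 2)                             ≡⟨ three-copies N g n sizes ⟩
    (2 * n A + 1) + (2 * n B + 1) + (2 * n C + 1)       ≤⟨ +-mono-≤ (+-mono-≤ (bound A) (bound B)) (bound C) ⟩
    (t + 2 * h A) + (t + 2 * h B) + (t + 2 * h C)       ≡⟨ collect t (h A) (h B) (h C) ⟩
    3 * t + 2 * (h A + h B + h C)                       ≤⟨ +-monoʳ-≤ (3 * t) (*-monoʳ-≤ 2 (⌈a/2⌉+⌈b/2⌉+⌈c/2⌉≤1+⌈a+b+c/2⌉ (c A) (c B) (c C))) ⟩
    3 * t + 2 * suc ⌈ c A + c B + c C /2⌉               ≡⟨ cong (λ x → 3 * t + 2 * suc x) (trans (cong ⌈_/2⌉ corners≡) (⌈2m+n/2⌉≡m+⌈n/2⌉ g w)) ⟩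
    3 * t + 2 * suc (g + ⌈ w /2⌉)                       ≡⟨ separate t g ⌈ w /2⌉ ⟩
    3 * t + 2 * ⌈ w /2⌉ + (2 * g + 2)                   ∎)
  where
  open ≤-Reasoning
  h : Corner → ℕ
  h θ = ⌈ c θ /2⌉
  separate : ∀ t g x → 3 * t + 2 * suc (g + x) ≡ 3 * t + 2 * x + (2 * g + 2)
  separate = solve-∀

exact-step : ∀ t N g w (n c : Corner → ℕ) →
  N + g ≡ n A + n B + n C → c A + c B + c C ≡ w + g + 1 →
  (∀ θ → 2 * n θ + 1 ≡ t + 2 * c θ) → 2 * N + 1 ≡ 3 * t + 2 * w
exact-step t N g w n c sizes weights exact =
  +-cancelʳ-≡ (2 * g + 2) (2 * N + 1) (3 * t + 2 * w) (begin
    2 * N + 1 + (2 * g + 2)                         ≡⟨ three-copies N g n sizes ⟩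
    (2 * n A + 1) + (2 * n B + 1) + (2 * n C + 1)   ≡⟨ cong₂ _+_ (cong₂ _+_ (exact A) (exact B)) (exact C) ⟩
    (t + 2 * c A) + (t + 2 * c B) + (t + 2 * c C)   ≡⟨ collect t (c A) (c B) (c C) ⟩
    3 * t + 2 * (c A + c B + c C)                   ≡⟨ cong (λ x → 3 * t + 2 * x) weights ⟩
    3 * t + 2 * (w + g + 1)                         ≡⟨ separate t g w ⟩
    3 * t + 2 * w + (2 * g + 2)                     ∎)
  where
  open ≡-Reasoning
  separate : ∀ t g w → 3 * t + 2 * (w + g + 1) ≡ 3 * t + 2 * w + (2 * g + 2)
  separate = solve-∀

-- The upper bound

pairwise-exclusive⇒sum≤1 : ∀ a b c → (T a → T b → ⊥) → (T a → T c → ⊥) → (T b → T c → ⊥) →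
  bit a + (bit b + (bit c + 0)) ≤ 1
pairwise-exclusive⇒sum≤1 true  true  _     a∧b _   _   = ⊥-elim (a∧b _ _)
pairwise-exclusive⇒sum≤1 true  false true  _   a∧c _   = ⊥-elim (a∧c _ _)
pairwise-exclusive⇒sum≤1 false true  true  _   _   b∧c = ⊥-elim (b∧c _ _)
pairwise-exclusive⇒sum≤1 true  false false _   _   _   = ≤-refl
pairwise-exclusive⇒sum≤1 false true  false _   _   _   = ≤-refl
pairwise-exclusive⇒sum≤1 false false true  _   _   _   = ≤-refl
pairwise-exclusive⇒sum≤1 false false false _   _   _   = z≤n

triangle-bound : ∀ {w} → w ≤ 1 → 2 * w + 1 ≤ 3 ^ 0 + 2 * ⌈ w /2⌉
triangle-bound z≤n       = ≤-refl
triangle-bound (s≤s z≤n) = ≤-refl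

independent⇒size-bound : ∀ k P → Independent k P → 2 * size k P + 1 ≤ 3 ^ k + 2 * ⌈ corners P /2⌉
independent⇒size-bound zero P independent =
  triangle-bound (pairwise-exclusive⇒sum≤1 (P (out A)) (P (out B)) (P (out C))
    (independent (base {A} {B} (λ ()))) (independent (base {A} {C} (λ ()))) (independent (base {B} {C} (λ ()))))
independent⇒size-bound (suc k) P independent =
  bound-step (3 ^ k) (size (suc k) P) (gluings P) (corners P) (λ θ → size k (P ∘ embed θ)) (λ θ → corners (P ∘ embed θ))
    (size-suc k P) (corners-suc P) copy
  where
  copy : ∀ θ → 2 * size k (P ∘ embed θ) + 1 ≤ 3 ^ k + 2 * ⌈ corners (P ∘ embed θ) /2⌉
  copy θ = independent⇒size-bound k (P ∘ embed θ) (restrict-independent independent θ)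

-- Extremal independent sets

-- An extremal set is described by a label: the outmost vertex it contains, if any.
includes : Maybe Corner → Corner → Bool
includes nothing  _ = false
includes (just c) d = ⌊ c ≟ᶜ d ⌋

weight : Maybe Corner → ℕ
weight nothing  = 0
weight (just _) = 1

includes⇒≡just : ∀ s c → T (includes s c) → s ≡ just c
includes⇒≡just (just d) c d≡c = cong just (toWitness {a? = d ≟ᶜ c} d≡c)

-- Without outmost vertices, the set uses the gluing point B⁽¹⁾ = A⁽²⁾; containing corner c, it keeps c
-- in copy c and uses the gluing point of the other two copies. Every copy gets at most one outmost vertex.
copyLabels : Maybe Corner → Corner → Maybe Corner
copyLabels nothing  A = just B
copyLabels nothing  B = just A
copyLabels nothing  C = nothing
copyLabels (just A) A = just A
copyLabels (just A) B = just C
copyLabels (just A) C = just B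
copyLabels (just B) A = just C
copyLabels (just B) B = just B
copyLabels (just B) C = just A
copyLabels (just C) A = just B
copyLabels (just C) B = just A
copyLabels (just C) C = just C

Compatible : (Corner → Maybe Corner) → Set
Compatible L = includes (L A) B ≡ includes (L B) A × includes (L A) C ≡ includes (L C) A × includes (L B) C ≡ includes (L C) B

extremal : ∀ k → Maybe Corner → Vtx k → Bool
assemble : ∀ k → (Corner → Maybe Corner) → Vtx (suc k) → Bool

extremal zero    s (out c) = includes s c
extremal zero    s (inn ())
extremal (suc k) s         = assemble k (copyLabels s)

assemble k L (out c)            = includes (L c) c
assemble k L (inn (glued g12))  = includes (L A) B
assemble k L (inn (glued g13))  = includes (L A) C
assemble k L (inn (glued g23))  = includes (L B) C
assemble k L (inn (inCopy θ x)) = extremal k (L θ) (inn x)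

copyLabels-compatible : ∀ s → Compatible (copyLabels s)
copyLabels-compatible nothing  = refl , refl , refl
copyLabels-compatible (just A) = refl , refl , refl
copyLabels-compatible (just B) = refl , refl , refl
copyLabels-compatible (just C) = refl , refl , refl

copyLabels-diagonal : ∀ s c → includes (copyLabels s c) c ≡ includes s c
copyLabels-diagonal nothing  A = refl
copyLabels-diagonal nothing  B = refl
copyLabels-diagonal nothing  C = refl
copyLabels-diagonal (just A) A = refl
copyLabels-diagonal (just A) B = refl
copyLabels-diagonal (just A) C = refl
copyLabels-diagonal (just B) A = refl
copyLabels-diagonal (just B) B = refl
copyLabels-diagonal (just B) C = refl
copyLabels-diagonal (just C) A = refl
copyLabels-diagonal (just C) B = refl
copyLabels-diagonal (just C) C = refl

copyLabels-weight : ∀ {k} s → weight (copyLabels s A) + weight (copyLabels s B) + weight (copyLabels s C) ≡ weight s + gluings (assemble k (copyLabels s)) + 1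
copyLabels-weight nothing  = refl
copyLabels-weight (just A) = refl
copyLabels-weight (just B) = refl
copyLabels-weight (just C) = refl

extremal-out : ∀ k s c → extremal k s (out c) ≡ includes s c
extremal-out zero    s c = refl
extremal-out (suc k) s c = copyLabels-diagonal s c

assemble-embed-out : ∀ {k} L → Compatible L → ∀ θ c → assemble k L (embed θ (out c)) ≡ includes (L θ) c
assemble-embed-out L _            A A = refl
assemble-embed-out L _            A B = refl
assemble-embed-out L _            A C = refl
assemble-embed-out L (ab , _ , _) B A = ab
assemble-embed-out L _            B B = refl
assemble-embed-out L _            B C = refl
assemble-embed-out L (_ , ac , _) C A = ac
assemble-embed-out L (_ , _ , bc) C B = bc
assemble-embed-out L _            C C = refl

assemble-embed : ∀ {k} L → Compatible L → ∀ θ → assemble k L ∘ embed θ ≗ extremal k (L θ)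
assemble-embed {k} L compatible θ (out c) = trans (assemble-embed-out L compatible θ c) (sym (extremal-out k (L θ) c))
assemble-embed L compatible A (inn x) = refl
assemble-embed L compatible B (inn x) = refl
assemble-embed L compatible C (inn x) = refl

assemble-independent : ∀ {k} L → Compatible L → (∀ θ → Independent k (extremal k (L θ))) → Independent (suc k) (assemble k L)
assemble-independent L compatible independent (lift θ {u} {v} adj refl refl) u∈ v∈ =
  independent θ adj (subst T (assemble-embed L compatible θ u) u∈) (subst T (assemble-embed L compatible θ v) v∈)

extremal-independent : ∀ k s → Independent k (extremal k s)
extremal-independent zero    s (base {c} {d} c≢d) c∈ d∈ =
  c≢d (just-injective (trans (sym (includes⇒≡just s c c∈)) (includes⇒≡just s d d∈)))
extremal-independent (suc k) s =
  assemble-independent (copyLabels s) (copyLabels-compatible s) (λ θ → extremal-independent k (copyLabels s θ))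

assemble-size : ∀ k w L → Compatible L →
  weight (L A) + weight (L B) + weight (L C) ≡ w + gluings (assemble k L) + 1 →
  (∀ θ → 2 * size k (extremal k (L θ)) + 1 ≡ 3 ^ k + 2 * weight (L θ)) →
  2 * size (suc k) (assemble k L) + 1 ≡ 3 ^ suc k + 2 * w
assemble-size k w L compatible weights exact =
  exact-step (3 ^ k) (size (suc k) (assemble k L)) (gluings (assemble k L)) w
    (λ θ → size k (extremal k (L θ))) (λ θ → weight (L θ)) copies weights exact
  where
  copies : size (suc k) (assemble k L) + gluings (assemble k L) ≡
           size k (extremal k (L A)) + size k (extremal k (L B)) + size k (extremal k (L C))
  copies = trans (size-suc k (assemble k L))
    (cong₂ _+_ (cong₂ _+_ (size-cong k (assemble-embed L compatible A)) (size-cong k (assemble-embed L compatible B)))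
               (size-cong k (assemble-embed L compatible C)))

extremal-size : ∀ k s → 2 * size k (extremal k s) + 1 ≡ 3 ^ k + 2 * weight s
extremal-size zero    nothing  = refl
extremal-size zero    (just A) = refl
extremal-size zero    (just B) = refl
extremal-size zero    (just C) = refl
extremal-size (suc k) s        =
  assemble-size k (weight s) (copyLabels s) (copyLabels-compatible s) (copyLabels-weight {k} s) (λ θ → extremal-size k (copyLabels s θ))

labelsAB : Corner → Maybe Corner
labelsAB A = just A
labelsAB B = just B
labelsAB C = nothing

labelsAB-compatible : Compatible labelsAB
labelsAB-compatible = refl , refl , refl

_∈ᵇ_ : ∀ {k} → Vtx k → List (Vtx k) → Bool
v ∈ᵇ I = ⌊ any? (v ≟ᵛ_) I ⌋

∈ᵇ⇔∈ : ∀ {k} (I : List (Vtx k)) {v} → T (v ∈ᵇ I) ⇔ v ∈ I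
∈ᵇ⇔∈ I = mk⇔ toWitness fromWitness

independent-list-bound : ∀ {k j} I → IsIndependent (suc k) I → ContainsExactlyOut (suc k) I j →
  2 * length I + 1 ≤ 3 ^ k + 2 * ⌈ j /2⌉
independent-list-bound {k} I (I-unique , I-independent) (Cs , Cs-unique , refl , out∈I⇔∈Cs) = begin
  2 * length I + 1             ≡⟨ cong (λ n → 2 * n + 1) length-I ⟩
  2 * size k P + 1             ≤⟨ independent⇒size-bound k P P-independent ⟩
  3 ^ k + 2 * ⌈ corners P /2⌉  ≡⟨ cong (λ n → 3 ^ k + 2 * ⌈ n /2⌉) (sym length-Cs) ⟩
  3 ^ k + 2 * ⌈ length Cs /2⌉  ∎
  where
  open ≤-Reasoning
  P : Vtx k → Bool
  P v = v ∈ᵇ I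
  P-independent : Independent k P
  P-independent adj u∈ v∈ = I-independent (to (∈ᵇ⇔∈ I) u∈) (to (∈ᵇ⇔∈ I) v∈) adj
  length-I : length I ≡ size k P
  length-I = length≡count (allVtx-unique k) (∈-allVtx k) I-unique (λ v → ⇔-sym (∈ᵇ⇔∈ I))
  length-Cs : length Cs ≡ corners P
  length-Cs = length≡count allCorner-unique ∈-allCorner Cs-unique
    (λ c → ⇔-trans (⇔-sym (out∈I⇔∈Cs c)) (⇔-sym (∈ᵇ⇔∈ I)))

maxIndepOut-attained : ∀ {k} (P : Vtx k → Bool) → Independent k P →
  2 * size k P + 1 ≡ 3 ^ k + 2 * ⌈ corners P /2⌉ → MaxIndepOut (suc k) (corners P) (size k P)
maxIndepOut-attained {k} P P-independent attained =
  (members , independent , exactly , length-filterᵇ P (allVtx k)) , maximal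
  where
  members : List (Vtx k)
  members = filterᵇ P (allVtx k)
  ∈members : ∀ {v} → v ∈ members ⇔ T (P v)
  ∈members = ∈-filterᵇ {P = P} (∈-allVtx k)
  independent : IsIndependent (suc k) members
  independent = filter⁺ (T? ∘ P) (allVtx-unique k) ,
                λ u∈ v∈ adj → P-independent adj (to ∈members u∈) (to ∈members v∈)
  exactly : ContainsExactlyOut (suc k) members (corners P)
  exactly = filterᵇ (P ∘ out) allCorner , filter⁺ (T? ∘ P ∘ out) allCorner-unique ,
            length-filterᵇ (P ∘ out) allCorner , λ c → ⇔-trans ∈members (⇔-sym (∈-filterᵇ {P = P ∘ out} ∈-allCorner))
  maximal : ∀ I → IsIndependent (suc k) I → ContainsExactlyOut (suc k) I (corners P) → length I ≤ size k P
  maximal I I-independent I-exactly =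
    *-cancelˡ-≤ 2 (+-cancelʳ-≤ 1 (2 * length I) (2 * size k P)
      (≤-trans (independent-list-bound I I-independent I-exactly) (≤-reflexive (sym attained))))

2m+1≡n⇒m≡[n∸1]/2 : ∀ {m n} → 2 * m + 1 ≡ n → m ≡ (n ∸ 1) / 2
2m+1≡n⇒m≡[n∸1]/2 {m} refl =
  sym (trans (cong (_/ 2) (trans (m+n∸n≡m (2 * m) 1) (*-comm 2 m))) (m*n/n≡m m 2))

mainTheorem10 : (n : ℕ) → 2 ≤ n →
    MaxIndepOut n 0 ((3 ^ (n ∸ 1) ∸ 1) / 2) ×
    MaxIndepOut n 1 ((3 ^ (n ∸ 1) + 1) / 2) ×
    MaxIndepOut n 2 ((3 ^ (n ∸ 1) + 1) / 2)
mainTheorem10 (suc zero)    (s≤s ())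
mainTheorem10 (suc (suc m)) _ =
    optimal (extremal (suc m) nothing) (extremal-independent (suc m) nothing) (extremal-size (suc m) nothing)
      (cong (λ x → (x ∸ 1) / 2) (+-identityʳ t))
  , optimal (extremal (suc m) (just A)) (extremal-independent (suc m) (just A)) (extremal-size (suc m) (just A))
      (cong (_/ 2) (+-∸-assoc t (s≤s z≤n)))
  , optimal (assemble m labelsAB)
      (assemble-independent labelsAB labelsAB-compatible (λ θ → extremal-independent m (labelsAB θ)))
      (assemble-size m 1 labelsAB labelsAB-compatible refl (λ θ → extremal-size m (labelsAB θ)))
      (cong (_/ 2) (+-∸-assoc t (s≤s z≤n)))
  where
  t : ℕ
  t = 3 ^ suc m
  optimal : ∀ P {target} → Independent (suc m) P → 2 * size (suc m) P + 1 ≡ t + 2 * ⌈ corners P /2⌉ →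
    (t + 2 * ⌈ corners P /2⌉ ∸ 1) / 2 ≡ target → MaxIndepOut (suc (suc m)) (corners P) target
  optimal P P-independent attained ≡target =
    subst (MaxIndepOut (suc (suc m)) (corners P)) (trans (2m+1≡n⇒m≡[n∸1]/2 attained) ≡target) (maxIndepOut-attained P P-independent attained)
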